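{- For every $i\in\mathbb{N}$ (with $i\ge1$) there is a $(2^{i-1}-1,\,i,\,2^{i-1},\,2^i-1)$-blurer.
   Context: For $\Xi\subseteq\mathbb{Z}_{2^q}^d$, $N\subseteq[d]$, $\bar b\in\mathbb{Z}_{2^q}^{|N|}$ let $\#_{N,\bar b}(\Xi)=|\{\bar c\in\Xi:\bar c|_N=\bar b\}|\bmod2$, where $\bar c|_N$ is the restriction to indices in $N$ (in increasing order). For $d\ge k$ and $a\in\mathbb{Z}_{2^q}$, $\Xi$ is a $(k,q,a,d)$-blurer if for all $N\subseteq[d]$ with $|N|=k$: (1) $\sum_j\xi(j)=0$ in $\mathbb{Z}_{2^q}$ for all $\xi\in\Xi$; (2) if $1\in N$ then $\#_{N,(a,0,\dots,0)}(\Xi)=1$; (3) if $1\notin N$ then $\#_{N,\bar0}(\Xi)=1$; (4) $\#_{N,\bar b}(\Xi)=0$ for all other pairs $N,\bar b$. -}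

module Defs where

open import Data.Nat using (ℕ; zero; suc; _+_; _∸_; _^_; _≤_; _<_; _≟_)
open import Data.Nat.DivMod using (_%_)
open import Data.Nat.Divisibility using (_∣_)
open import Data.Bool using (Bool; true; false)
open import Data.List using (List; []; _∷_; length; filter; replicate)
import Data.List.Properties as LP
open import Data.List.Relation.Unary.All using (All)
open import Data.List.Relation.Unary.Unique.Propositional using (Unique)
open import Data.Vec as V using (Vec; []; _∷_)
import Data.Vec.Relation.Unary.All as VA
open import Data.Fin.Subset using (Subset; ∣_∣)
open import Data.Product using (Σ)
open import Relation.Binary.PropositionalEquality using (_≡_; _≢_)

-- Elements of ℤ_{2^q} are represented by their canonical representatives
-- n ∈ ℕ with n < 2^q.  A vector in ℤ_{2^q}^d is a Vec ℕ d with all entries < 2^q.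
InZ : ℕ → ℕ → Set
InZ q n = n < 2 ^ q

VecZ : ℕ → (d : ℕ) → Vec ℕ d → Set
VecZ q d v = VA.All (InZ q) v

restrict : ∀ {d} → Subset d → Vec ℕ d → List ℕ
restrict []          []       = []
restrict (true ∷ N)  (x ∷ c)  = x ∷ restrict N c
restrict (false ∷ N) (x ∷ c)  = restrict N c

-- does the first index (index 1 in the paper) lie in N?
firstIn : ∀ {d} → Subset d → Bool
firstIn []      = false
firstIn (x ∷ _) = x

parityCount : ∀ {d} → Subset d → List ℕ → List (Vec ℕ d) → ℕ
parityCount N b Ξ =
  length (filter (λ c → LP.≡-dec _≟_ (restrict N c) b) Ξ) % 2

-- sum of the entries of a vector (in ℕ; reduced mod 2^q via divisibility)
vsum : ∀ {d} → Vec ℕ d → ℕ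
vsum []      = 0
vsum (x ∷ v) = x + vsum v

-- Ξ ⊆ ℤ_{2^q}^d is given as a duplicate-free list of vectors.
-- (k,q,a,d)-blurer (with d ≥ k and a ∈ ℤ_{2^q}).
record IsBlurer (k q a d : ℕ) (Ξ : List (Vec ℕ d)) : Set where
  field
    k≤d     : k ≤ d
    a∈Z     : InZ q a
    inZ     : All (VecZ q d) Ξ
    distinct : Unique Ξ
    sumZero : All (λ ξ → 2 ^ q ∣ vsum ξ) Ξ
    cond2 : ∀ (N : Subset d) → ∣ N ∣ ≡ k → firstIn N ≡ true →
            parityCount N (a ∷ replicate (k ∸ 1) 0) Ξ ≡ 1
    cond3 : ∀ (N : Subset d) → ∣ N ∣ ≡ k → firstIn N ≡ false →
            parityCount N (replicate k 0) Ξ ≡ 1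
    -- (4) all other pairs (N, b̄) with b̄ ∈ ℤ_{2^q}^{|N|}: #_{N,b̄}(Ξ) = 0
    cond4 : ∀ (N : Subset d) → ∣ N ∣ ≡ k → (b : Vec ℕ k) → VecZ q k b →
            (firstIn N ≡ true  → V.toList b ≢ a ∷ replicate (k ∸ 1) 0) →
            (firstIn N ≡ false → V.toList b ≢ replicate k 0) →
            parityCount N (V.toList b) Ξ ≡ 0

Blurer : (k q a d : ℕ) → Set
Blurer k q a d = Σ (List (Vec ℕ d)) (IsBlurer k q a d)

{-# OPTIONS --safe #-}
-- Let a = 2^(i-1) and k = a - 1.  Take Ξ to be the vectors (a, c) with c ∈ {0,1}^(2k) of weight a,
-- together with the vectors (a + 1, c) with c of weight k; every coordinate sum is 2a = 2^i.
-- Fix N of size k.  On the coordinates other than the first, only a 0/1 pattern of some weight t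
-- can match, and then the number of matches is a binomial coefficient C(a, r):
-- if 1 ∉ N it is C(k, a - t) + C(k, k - t) = C(a, a - t) by Pascal's rule; if 1 ∈ N the first
-- entry (a or a + 1) selects one of the two halves and leaves 2k - (k - 1) = a free coordinates,
-- giving C(a, a - t) resp. C(a, k - t).  As a is a power of 2, C(a, r) is odd only for r ∈ {0, a},
-- which singles out exactly the patterns (a, 0, …, 0) and 0̄.  For i = 1 the singleton {(0)} works.
module Submission where

open import Defs
open import Data.Nat using (ℕ; zero; suc; _+_; _*_; _∸_; _^_; _%_; _≤_; _<_; z≤n; s≤s; z<s; _≟_)
open import Data.Nat.Properties
open import Data.Nat.Combinatorics using (_C_; nCn≡1; nCk+nC[k+1]≡[n+1]C[k+1])
open import Data.Nat.Divisibility using (_∣_; _∣?_; divides; _∣0; 1∣_; ∣-refl; ∣-trans; ∣⇒≤; m∣m*n; *-monoˡ-∣; *-cancelˡ-∣; n∣m⇒m%n≡0)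
open import Data.Nat.Primality using (Prime; prime[2]; prime⇒nonZero; euclidsLemma)
open import Data.Maybe using (Maybe; just; nothing)
import Data.Maybe as Maybe
open import Data.Bool using (true; false)
open import Data.List using (List; []; _∷_; length; filter; replicate; map; _++_)
import Data.List.Properties as LP
import Data.List.Relation.Unary.All as All
import Data.List.Relation.Unary.All.Properties as All
open import Data.List.Relation.Unary.AllPairs using ([]; _∷_)
open import Data.List.Relation.Unary.Unique.Propositional using (Unique)
import Data.List.Relation.Unary.Unique.Propositional.Properties as Unique
open import Data.List.Relation.Binary.Disjoint.Propositional using (Disjoint)
open import Data.List.Membership.Propositional.Properties using (∈-map⁻)
open import Data.Vec using (Vec; []; _∷_; toList)
import Data.Vec.Properties as VecP
import Data.Vec.Relation.Unary.All as VecAll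
open import Data.Fin.Subset using (Subset; ∣_∣)
open import Data.Fin.Subset.Properties using (∣p∣≤n)
open import Data.Product using (_,_)
open import Data.Sum using (inj₁; inj₂)
open import Function using (_∘_)
open import Level using (0ℓ)
open import Relation.Nullary using (¬_; yes; no; contradiction)
open import Relation.Unary using (Pred; Decidable)
open import Relation.Binary.PropositionalEquality

[k+1]*[n+1]C[k+1]≡[n+1]*nCk : ∀ n k → suc k * (suc n C suc k) ≡ suc n * (n C k)
[k+1]*[n+1]C[k+1]≡[n+1]*nCk zero    zero    = refl
[k+1]*[n+1]C[k+1]≡[n+1]*nCk zero    (suc k) = *-zeroʳ (suc (suc k))
[k+1]*[n+1]C[k+1]≡[n+1]*nCk (suc n) k       = begin
  suc k * (suc (suc n) C suc k)                 ≡⟨ cong (suc k *_) (nCk+nC[k+1]≡[n+1]C[k+1] (suc n) k) ⟨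
  suc k * (suc n C k + suc n C suc k)           ≡⟨ *-distribˡ-+ (suc k) (suc n C k) _ ⟩
  suc k * (suc n C k) + suc k * (suc n C suc k) ≡⟨ cong (suc k * (suc n C k) +_) ([k+1]*[n+1]C[k+1]≡[n+1]*nCk n k) ⟩
  suc k * (suc n C k) + suc n * (n C k)         ≡⟨ +-assoc (suc n C k) (k * (suc n C k)) _ ⟩
  suc n C k + (k * (suc n C k) + suc n * (n C k)) ≡⟨ cong (suc n C k +_) (k*[n+1]Ck+[n+1]*nCk k) ⟩
  suc (suc n) * (suc n C k)                     ∎
  where
  open ≡-Reasoning
  k*[n+1]Ck+[n+1]*nCk : ∀ k → k * (suc n C k) + suc n * (n C k) ≡ suc n * (suc n C k)
  k*[n+1]Ck+[n+1]*nCk zero    = refl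
  k*[n+1]Ck+[n+1]*nCk (suc k) = begin
    suc k * (suc n C suc k) + suc n * (n C suc k) ≡⟨ cong (_+ suc n * (n C suc k)) ([k+1]*[n+1]C[k+1]≡[n+1]*nCk n k) ⟩
    suc n * (n C k) + suc n * (n C suc k)         ≡⟨ *-distribˡ-+ (suc n) (n C k) _ ⟨
    suc n * (n C k + n C suc k)                   ≡⟨ cong (suc n *_) (nCk+nC[k+1]≡[n+1]C[k+1] n k) ⟩
    suc n * (suc n C suc k)                       ∎

p^m∣n*o⇒p∤o⇒p^m∣n : ∀ {p} m n o → Prime p → p ^ m ∣ n * o → ¬ p ∣ o → p ^ m ∣ n
p^m∣n*o⇒p∤o⇒p^m∣n zero    n o _  _ _ = 1∣ n
p^m∣n*o⇒p∤o⇒p^m∣n {p} (suc m) n o pp p^m+1∣no p∤o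
  with euclidsLemma n o pp (∣-trans (m∣m*n (p ^ m)) p^m+1∣no)
... | inj₂ p∣o = contradiction p∣o p∤o
... | inj₁ (divides n′ refl) = subst (_∣ n′ * p) (*-comm (p ^ m) p) (*-monoˡ-∣ p p^m∣n′)
  where
  instance _ = prime⇒nonZero pp
  p^m∣n′ : p ^ m ∣ n′
  p^m∣n′ = p^m∣n*o⇒p∤o⇒p^m∣n m n′ o pp
    (*-cancelˡ-∣ p (subst (p * p ^ m ∣_) (trans (cong (_* o) (*-comm n′ p)) (*-assoc p n′ o)) p^m+1∣no))
    p∤o

-- r C(p^m, r) = p^m C(p^m - 1, r - 1), so if p ∤ C(p^m, r) then p^m ∣ r.
p∣[p^m]Cr : ∀ {p} m r → Prime p → 0 < r → r < p ^ m → p ∣ p ^ m C r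
p∣[p^m]Cr {p} m (suc s) pp _ r<p^m with p ^ m in eq
... | suc n with p ∣? (suc n C suc s)
...   | yes p∣C = p∣C
...   | no  p∤C = contradiction (∣⇒≤ p^m∣r) (<⇒≱ r<p^m)
  where
  p^m∣[1+s]*C : p ^ m ∣ suc s * (suc n C suc s)
  p^m∣[1+s]*C = subst₂ _∣_ (sym eq) (sym ([k+1]*[n+1]C[k+1]≡[n+1]*nCk n s)) (m∣m*n (n C s))
  p^m∣r : suc n ∣ suc s
  p^m∣r = subst (_∣ suc s) eq (p^m∣n*o⇒p∤o⇒p^m∣n m (suc s) _ pp p^m∣[1+s]*C p∤C)

length-filter-map : ∀ {A B : Set} {P : Pred B 0ℓ} (P? : Decidable P) (f : A → B) xs →
                    length (filter P? (map f xs)) ≡ length (filter (P? ∘ f) xs)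
length-filter-map P? f []       = refl
length-filter-map P? f (x ∷ xs) with P? (f x)
... | yes _ = cong suc (length-filter-map P? f xs)
... | no  _ = length-filter-map P? f xs

matchCount : ∀ {d} → Subset d → List ℕ → List (Vec ℕ d) → ℕ
matchCount N b Ξ = length (filter (λ c → LP.≡-dec _≟_ (restrict N c) b) Ξ)

matchCount-++ : ∀ {d} (N : Subset d) b xs ys →
                matchCount N b (xs ++ ys) ≡ matchCount N b xs + matchCount N b ys
matchCount-++ N b xs ys = trans (cong length (LP.filter-++ _ xs ys)) (LP.length-++ (filter _ xs))

matchCount-skip : ∀ {d} (N : Subset d) b v xs → matchCount (false ∷ N) b (map (v ∷_) xs) ≡ matchCount N b xs
matchCount-skip N b v = length-filter-map _ (v ∷_)

matchCount-hit : ∀ {d} (N : Subset d) b v xs → matchCount (true ∷ N) (v ∷ b) (map (v ∷_) xs) ≡ matchCount N b xs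
matchCount-hit N b v xs = trans (length-filter-map _ (v ∷_) xs)
  (cong length (LP.filter-≐ _ _ (LP.∷-injectiveʳ , cong (v ∷_)) xs))

matchCount-miss : ∀ {d} (N : Subset d) b {v y} xs → v ≢ y → matchCount (true ∷ N) (y ∷ b) (map (v ∷_) xs) ≡ 0
matchCount-miss N b xs v≢y = trans (length-filter-map _ (_ ∷_) xs)
  (cong length (LP.filter-none _ (All.universal (λ _ → v≢y ∘ LP.∷-injectiveˡ) xs)))

module _ {d} (N : Subset d) (b : List ℕ) {u v : ℕ} (A B : List (Vec ℕ d)) where

  matchCount-blocks-skip : matchCount (false ∷ N) b (map (u ∷_) A ++ map (v ∷_) B) ≡ matchCount N b A + matchCount N b B
  matchCount-blocks-skip =
    trans (matchCount-++ (false ∷ N) b (map (u ∷_) A) _) (cong₂ _+_ (matchCount-skip N b u A) (matchCount-skip N b v B))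

  matchCount-blocks-left : u ≢ v → matchCount (true ∷ N) (u ∷ b) (map (u ∷_) A ++ map (v ∷_) B) ≡ matchCount N b A
  matchCount-blocks-left u≢v =
    trans (matchCount-++ (true ∷ N) (u ∷ b) (map (u ∷_) A) _)
          (trans (cong₂ _+_ (matchCount-hit N b u A) (matchCount-miss N b B (u≢v ∘ sym))) (+-identityʳ _))

  matchCount-blocks-right : u ≢ v → matchCount (true ∷ N) (v ∷ b) (map (u ∷_) A ++ map (v ∷_) B) ≡ matchCount N b B
  matchCount-blocks-right u≢v =
    trans (matchCount-++ (true ∷ N) (v ∷ b) (map (u ∷_) A) _)
          (cong₂ _+_ (matchCount-miss N b A u≢v) (matchCount-hit N b v B))

  matchCount-blocks-none : ∀ {y} → y ≢ u → y ≢ v → matchCount (true ∷ N) (y ∷ b) (map (u ∷_) A ++ map (v ∷_) B) ≡ 0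
  matchCount-blocks-none {y} y≢u y≢v =
    trans (matchCount-++ (true ∷ N) (y ∷ b) (map (u ∷_) A) _)
          (cong₂ _+_ (matchCount-miss N b A (y≢u ∘ sym)) (matchCount-miss N b B (y≢v ∘ sym)))

binaryVecs : (L w : ℕ) → List (Vec ℕ L)
binaryVecs zero    zero    = [] ∷ []
binaryVecs zero    (suc w) = []
binaryVecs (suc L) zero    = map (0 ∷_) (binaryVecs L zero)
binaryVecs (suc L) (suc w) = map (0 ∷_) (binaryVecs L (suc w)) ++ map (1 ∷_) (binaryVecs L w)

binaryWeight : List ℕ → Maybe ℕ
binaryWeight []                = just 0
binaryWeight (zero ∷ b)        = binaryWeight b
binaryWeight (suc zero ∷ b)    = Maybe.map suc (binaryWeight b)
binaryWeight (suc (suc _) ∷ b) = nothing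

-- completions n (binaryWeight b) w counts the ways to complete a pattern b by n free bits to total
-- weight w: C(n, w - t) if b is a 0/1 pattern of weight t ≤ w, and 0 otherwise.
completions : ℕ → Maybe ℕ → ℕ → ℕ
completions n nothing        w       = 0
completions n (just zero)    w       = n C w
completions n (just (suc t)) zero    = 0
completions n (just (suc t)) (suc w) = completions n (just t) w

completions-0-indep : ∀ n n′ mt → completions n mt 0 ≡ completions n′ mt 0
completions-0-indep n n′ nothing        = refl
completions-0-indep n n′ (just zero)    = refl
completions-0-indep n n′ (just (suc t)) = refl

completions-map-suc : ∀ n mt w → completions n (Maybe.map suc mt) (suc w) ≡ completions n mt w
completions-map-suc n nothing  w = refl
completions-map-suc n (just t) w = refl

completions-map-suc-0 : ∀ n mt → completions n (Maybe.map suc mt) 0 ≡ 0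
completions-map-suc-0 n nothing  = refl
completions-map-suc-0 n (just t) = refl

completions-pascal : ∀ n mt w → completions (suc n) mt (suc w) ≡ completions n mt (suc w) + completions n mt w
completions-pascal n nothing        w       = refl
completions-pascal n (just zero)    w       = sym (trans (+-comm (n C suc w) (n C w)) (nCk+nC[k+1]≡[n+1]C[k+1] n w))
completions-pascal n (just (suc t)) zero    = sym (trans (+-identityʳ _) (completions-0-indep n (suc n) (just t)))
completions-pascal n (just (suc t)) (suc w) = completions-pascal n (just t) w

matchCount-binaryVecs : ∀ L (N : Subset L) b w → length b ≡ ∣ N ∣ →
  matchCount N b (binaryVecs L w) ≡ completions (L ∸ ∣ N ∣) (binaryWeight b) w
matchCount-binaryVecs zero    []          []      zero    _   = refl
matchCount-binaryVecs zero    []          []      (suc w) _   = refl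
matchCount-binaryVecs (suc L) (false ∷ N) b       zero    ∣b∣ =
  trans (matchCount-skip N b 0 (binaryVecs L 0))
        (trans (matchCount-binaryVecs L N b 0 ∣b∣) (completions-0-indep _ _ (binaryWeight b)))
matchCount-binaryVecs (suc L) (false ∷ N) b       (suc w) ∣b∣ = begin
  matchCount (false ∷ N) b (binaryVecs (suc L) (suc w))
    ≡⟨ matchCount-blocks-skip N b (binaryVecs L (suc w)) (binaryVecs L w) ⟩
  matchCount N b (binaryVecs L (suc w)) + matchCount N b (binaryVecs L w)
    ≡⟨ cong₂ _+_ (matchCount-binaryVecs L N b (suc w) ∣b∣) (matchCount-binaryVecs L N b w ∣b∣) ⟩
  completions (L ∸ ∣ N ∣) (binaryWeight b) (suc w) + completions (L ∸ ∣ N ∣) (binaryWeight b) w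
    ≡⟨ completions-pascal (L ∸ ∣ N ∣) (binaryWeight b) w ⟨
  completions (suc (L ∸ ∣ N ∣)) (binaryWeight b) (suc w)
    ≡⟨ cong (λ n → completions n (binaryWeight b) (suc w)) (+-∸-assoc 1 (∣p∣≤n N)) ⟨
  completions (suc L ∸ ∣ N ∣) (binaryWeight b) (suc w)
    ∎
  where open ≡-Reasoning
matchCount-binaryVecs (suc L) (true ∷ N) (0 ∷ b) zero ∣0∷b∣ =
  trans (matchCount-hit N b 0 (binaryVecs L 0)) (matchCount-binaryVecs L N b 0 (suc-injective ∣0∷b∣))
matchCount-binaryVecs (suc L) (true ∷ N) (0 ∷ b) (suc w) ∣0∷b∣ =
  trans (matchCount-blocks-left N b (binaryVecs L (suc w)) (binaryVecs L w) (λ ()))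
        (matchCount-binaryVecs L N b (suc w) (suc-injective ∣0∷b∣))
matchCount-binaryVecs (suc L) (true ∷ N) (1 ∷ b) zero _ =
  trans (matchCount-miss N b (binaryVecs L 0) (λ ())) (sym (completions-map-suc-0 (L ∸ ∣ N ∣) (binaryWeight b)))
matchCount-binaryVecs (suc L) (true ∷ N) (1 ∷ b) (suc w) ∣1∷b∣ =
  trans (matchCount-blocks-right N b (binaryVecs L (suc w)) (binaryVecs L w) (λ ()))
        (trans (matchCount-binaryVecs L N b w (suc-injective ∣1∷b∣))
               (sym (completions-map-suc (L ∸ ∣ N ∣) (binaryWeight b) w)))
matchCount-binaryVecs (suc L) (true ∷ N) (suc (suc y) ∷ b) zero _ =
  matchCount-miss N b (binaryVecs L 0) (λ ())
matchCount-binaryVecs (suc L) (true ∷ N) (suc (suc y) ∷ b) (suc w) _ =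
  matchCount-blocks-none N b (binaryVecs L (suc w)) (binaryVecs L w) (λ ()) (λ ())

binaryWeight-replicate : ∀ n → binaryWeight (replicate n 0) ≡ just 0
binaryWeight-replicate zero    = refl
binaryWeight-replicate (suc n) = binaryWeight-replicate n

binaryWeight≤length : ∀ b {t} → binaryWeight b ≡ just t → t ≤ length b
binaryWeight≤length []                refl = z≤n
binaryWeight≤length (zero ∷ b)        eq   = m≤n⇒m≤1+n (binaryWeight≤length b eq)
binaryWeight≤length (suc zero ∷ b)    eq   with binaryWeight b in eq′
binaryWeight≤length (suc zero ∷ b)    refl | just t = s≤s (binaryWeight≤length b eq′)
binaryWeight≤length (suc (suc _) ∷ b) ()

binaryWeight≡0⇒replicate : ∀ b → binaryWeight b ≡ just 0 → b ≡ replicate (length b) 0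
binaryWeight≡0⇒replicate []                _  = refl
binaryWeight≡0⇒replicate (zero ∷ b)        eq = cong (0 ∷_) (binaryWeight≡0⇒replicate b eq)
binaryWeight≡0⇒replicate (suc zero ∷ b)    eq with binaryWeight b
binaryWeight≡0⇒replicate (suc zero ∷ b)    () | just _
binaryWeight≡0⇒replicate (suc zero ∷ b)    () | nothing
binaryWeight≡0⇒replicate (suc (suc _) ∷ b) ()

completions-just : ∀ n {t w} → t ≤ w → completions n (just t) w ≡ n C (w ∸ t)
completions-just n {zero}              _         = refl
completions-just n {suc t} {suc w} (s≤s t≤w) = completions-just n t≤w

completions-zeros : ∀ n ℓ → completions n (binaryWeight (replicate ℓ 0)) n ≡ 1
completions-zeros n ℓ rewrite binaryWeight-replicate ℓ = nCn≡1 n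

p∣completions : ∀ {p} m {t w} → Prime p → t < w → w ∸ t < p ^ m → p ∣ completions (p ^ m) (just t) w
p∣completions {p} m {t} {w} pp t<w w∸t<p^m =
  subst (p ∣_) (sym (completions-just (p ^ m) (<⇒≤ t<w))) (p∣[p^m]Cr m (w ∸ t) pp (m<n⇒0<n∸m t<w) w∸t<p^m)

p∣completions-top : ∀ {p m n} b → Prime p → n ≡ p ^ m → length b < n → b ≢ replicate (length b) 0 →
                    p ∣ completions n (binaryWeight b) n
p∣completions-top {p} {m} b pp refl ∣b∣<n b≢0 with binaryWeight b in eq
... | nothing      = p ∣0
... | just zero    = contradiction (binaryWeight≡0⇒replicate b eq) b≢0
... | just (suc t) = p∣completions m pp t<n (∸-monoʳ-< z<s (<⇒≤ t<n))
  where
  t<n : suc t < p ^ m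
  t<n = ≤-<-trans (binaryWeight≤length b eq) ∣b∣<n

p∣completions-below : ∀ {p m n} b {w} → Prime p → n ≡ p ^ m → length b < w → w < n →
                      p ∣ completions n (binaryWeight b) w
p∣completions-below {p} {m} b {w} pp refl ∣b∣<w w<n with binaryWeight b in eq
... | nothing = p ∣0
... | just t  = p∣completions m pp (≤-<-trans (binaryWeight≤length b eq) ∣b∣<w) (≤-<-trans (m∸n≤m w t) w<n)

binaryVecs-sum : ∀ L w → All.All (λ c → vsum c ≡ w) (binaryVecs L w)
binaryVecs-sum zero    zero    = refl All.∷ All.[]
binaryVecs-sum zero    (suc w) = All.[]
binaryVecs-sum (suc L) zero    = All.map⁺ (binaryVecs-sum L zero)
binaryVecs-sum (suc L) (suc w) =
  All.++⁺ (All.map⁺ (binaryVecs-sum L (suc w))) (All.map⁺ (All.map (cong suc) (binaryVecs-sum L w)))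

binaryVecs-binary : ∀ L w → All.All (VecAll.All (_< 2)) (binaryVecs L w)
binaryVecs-binary zero    zero    = VecAll.[] All.∷ All.[]
binaryVecs-binary zero    (suc w) = All.[]
binaryVecs-binary (suc L) zero    = All.map⁺ (All.map (z<s VecAll.∷_) (binaryVecs-binary L zero))
binaryVecs-binary (suc L) (suc w) =
  All.++⁺ (All.map⁺ (All.map (z<s VecAll.∷_) (binaryVecs-binary L (suc w))))
          (All.map⁺ (All.map (s≤s z<s VecAll.∷_) (binaryVecs-binary L w)))

map-∷-disjoint : ∀ {L u v} (xs ys : List (Vec ℕ L)) → u ≢ v → Disjoint (map (u ∷_) xs) (map (v ∷_) ys)
map-∷-disjoint xs ys u≢v (u∈ , v∈) with ∈-map⁻ _ u∈ | ∈-map⁻ _ v∈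
... | _ , _ , refl | _ , _ , eq = u≢v (VecP.∷-injectiveˡ eq)

binaryVecs-unique : ∀ L w → Unique (binaryVecs L w)
binaryVecs-unique zero    zero    = All.[] ∷ []
binaryVecs-unique zero    (suc w) = []
binaryVecs-unique (suc L) zero    = Unique.map⁺ VecP.∷-injectiveʳ (binaryVecs-unique L zero)
binaryVecs-unique (suc L) (suc w) =
  Unique.++⁺ (Unique.map⁺ VecP.∷-injectiveʳ (binaryVecs-unique L (suc w)))
             (Unique.map⁺ VecP.∷-injectiveʳ (binaryVecs-unique L w))
             (map-∷-disjoint _ _ (λ ()))

blurSet : (k : ℕ) → List (Vec ℕ (suc (k + k)))
blurSet k = map (suc k ∷_) (binaryVecs (k + k) (suc k)) ++ map (2 + k ∷_) (binaryVecs (k + k) k)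

blurSet-sum : ∀ k → All.All (λ ξ → vsum ξ ≡ suc k + suc k) (blurSet k)
blurSet-sum k = All.++⁺ (All.map⁺ (All.map (cong (suc k +_)) (binaryVecs-sum (k + k) (suc k))))
                        (All.map⁺ (All.map (λ eq → cong suc (trans (cong (suc k +_) eq) (sym (+-suc k k)))) (binaryVecs-sum (k + k) k)))

blurSet-bounded : ∀ k → All.All (VecAll.All (_< 3 + k)) (blurSet k)
blurSet-bounded k = All.++⁺ (All.map⁺ (All.map (entries (n≤1+n (2 + k))) (binaryVecs-binary (k + k) (suc k))))
                            (All.map⁺ (All.map (entries ≤-refl) (binaryVecs-binary (k + k) k)))
  where
  entries : ∀ {v L} {c : Vec ℕ L} → v < 3 + k → VecAll.All (_< 2) c → VecAll.All (_< 3 + k) (v ∷ c)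
  entries v< c<2 = v< VecAll.∷ VecAll.map (λ x<2 → <-≤-trans x<2 (s≤s (s≤s z≤n))) c<2

blurSet-unique : ∀ k → Unique (blurSet k)
blurSet-unique k =
  Unique.++⁺ (Unique.map⁺ VecP.∷-injectiveʳ (binaryVecs-unique (k + k) (suc k)))
             (Unique.map⁺ VecP.∷-injectiveʳ (binaryVecs-unique (k + k) k))
             (map-∷-disjoint _ _ (1+n≢n ∘ sym))

matchCount-blurSet-∉ : ∀ k (N : Subset (k + k)) b → ∣ N ∣ ≡ k → length b ≡ k →
  matchCount (false ∷ N) b (blurSet k) ≡ completions (suc k) (binaryWeight b) (suc k)
matchCount-blurSet-∉ k N b ∣N∣ ∣b∣ = begin
  matchCount (false ∷ N) b (blurSet k)
    ≡⟨ matchCount-blocks-skip N b (binaryVecs (k + k) (suc k)) (binaryVecs (k + k) k) ⟩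
  matchCount N b (binaryVecs (k + k) (suc k)) + matchCount N b (binaryVecs (k + k) k)
    ≡⟨ cong₂ _+_ (matchCount-binaryVecs (k + k) N b (suc k) ∣b∣≡∣N∣) (matchCount-binaryVecs (k + k) N b k ∣b∣≡∣N∣) ⟩
  completions (k + k ∸ ∣ N ∣) (binaryWeight b) (suc k) + completions (k + k ∸ ∣ N ∣) (binaryWeight b) k
    ≡⟨ cong (λ n → completions n (binaryWeight b) (suc k) + completions n (binaryWeight b) k) free≡k ⟩
  completions k (binaryWeight b) (suc k) + completions k (binaryWeight b) k
    ≡⟨ completions-pascal k (binaryWeight b) k ⟨
  completions (suc k) (binaryWeight b) (suc k)
    ∎
  where
  open ≡-Reasoning
  ∣b∣≡∣N∣ : length b ≡ ∣ N ∣
  ∣b∣≡∣N∣ = trans ∣b∣ (sym ∣N∣)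
  free≡k : k + k ∸ ∣ N ∣ ≡ k
  free≡k = trans (cong (k + k ∸_) ∣N∣) (m+n∸n≡m k k)

module _ (j : ℕ) (N : Subset (suc j + suc j)) (b : List ℕ) (∣N∣ : ∣ N ∣ ≡ j) (∣b∣ : length b ≡ j) where

  private
    free≡2+j : suc j + suc j ∸ ∣ N ∣ ≡ 2 + j
    free≡2+j = trans (cong₂ _∸_ (cong suc (+-suc j j)) ∣N∣) (m+n∸n≡m (2 + j) j)

    matchCount-tail : ∀ w → matchCount N b (binaryVecs (suc j + suc j) w) ≡ completions (2 + j) (binaryWeight b) w
    matchCount-tail w = trans (matchCount-binaryVecs _ N b w (trans ∣b∣ (sym ∣N∣)))
                              (cong (λ n → completions n (binaryWeight b) w) free≡2+j)

    heavy light : List (Vec ℕ (suc j + suc j))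
    heavy = binaryVecs (suc j + suc j) (2 + j)
    light = binaryVecs (suc j + suc j) (suc j)

  matchCount-blurSet-∈-a : matchCount (true ∷ N) (2 + j ∷ b) (blurSet (suc j)) ≡ completions (2 + j) (binaryWeight b) (2 + j)
  matchCount-blurSet-∈-a = trans (matchCount-blocks-left N b heavy light (1+n≢n ∘ sym)) (matchCount-tail (2 + j))

  matchCount-blurSet-∈-a+1 : matchCount (true ∷ N) (3 + j ∷ b) (blurSet (suc j)) ≡ completions (2 + j) (binaryWeight b) (suc j)
  matchCount-blurSet-∈-a+1 = trans (matchCount-blocks-right N b heavy light (1+n≢n ∘ sym)) (matchCount-tail (suc j))

matchCount-blurSet-∈-other : ∀ k (N : Subset (k + k)) y b → y ≢ suc k → y ≢ 2 + k →
                             matchCount (true ∷ N) (y ∷ b) (blurSet k) ≡ 0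
matchCount-blurSet-∈-other k N y b =
  matchCount-blocks-none N b (binaryVecs (k + k) (suc k)) (binaryVecs (k + k) k)

module _ (m j : ℕ) (2+j≡2^m : 2 + j ≡ 2 ^ m) where

  private
    even : ∀ {x} → 2 ∣ x → x % 2 ≡ 0
    even = n∣m⇒m%n≡0 _ 2

    ≢replicate-length : ∀ {b ℓ} → length b ≡ ℓ → b ≢ replicate ℓ 0 → b ≢ replicate (length b) 0
    ≢replicate-length ∣b∣ b≢0 b≡0 = b≢0 (trans b≡0 (cong (λ ℓ → replicate ℓ 0) ∣b∣))

  matchCount-blurSet-∉-even : ∀ N b → ∣ N ∣ ≡ suc j → length b ≡ suc j → b ≢ replicate (suc j) 0 →
                              matchCount (false ∷ N) b (blurSet (suc j)) % 2 ≡ 0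
  matchCount-blurSet-∉-even N b ∣N∣ ∣b∣ b≢0 = even (subst (2 ∣_) (sym (matchCount-blurSet-∉ (suc j) N b ∣N∣ ∣b∣))
    (p∣completions-top {m = m} b prime[2] 2+j≡2^m (s≤s (≤-reflexive ∣b∣)) (≢replicate-length ∣b∣ b≢0)))

  matchCount-blurSet-∈-even : ∀ N y b → ∣ N ∣ ≡ j → length b ≡ j → y ∷ b ≢ 2 + j ∷ replicate j 0 →
                              matchCount (true ∷ N) (y ∷ b) (blurSet (suc j)) % 2 ≡ 0
  matchCount-blurSet-∈-even N y b ∣N∣ ∣b∣ y∷b≢a with y ≟ 2 + j | y ≟ 3 + j
  ... | yes refl | _        = even (subst (2 ∣_) (sym (matchCount-blurSet-∈-a j N b ∣N∣ ∣b∣))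
    (p∣completions-top {m = m} b prime[2] 2+j≡2^m (s≤s (≤-trans (≤-reflexive ∣b∣) (n≤1+n j)))
                       (≢replicate-length ∣b∣ (y∷b≢a ∘ cong (2 + j ∷_)))))
  ... | no _     | yes refl = even (subst (2 ∣_) (sym (matchCount-blurSet-∈-a+1 j N b ∣N∣ ∣b∣))
    (p∣completions-below {m = m} b prime[2] 2+j≡2^m (s≤s (≤-reflexive ∣b∣)) ≤-refl))
  ... | no y≢a   | no y≢a+1 = cong (_% 2) (matchCount-blurSet-∈-other (suc j) N y b y≢a y≢a+1)

  blurSet-isBlurer : IsBlurer (suc j) (suc m) (2 + j) (suc (suc j + suc j)) (blurSet (suc j))
  blurSet-isBlurer = record
    { k≤d      = ≤-trans (m≤m+n (suc j) (suc j)) (n≤1+n _)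
    ; a∈Z      = ≤-trans (n≤1+n (3 + j)) bound
    ; inZ      = All.map (VecAll.map (λ x< → <-≤-trans x< bound)) (blurSet-bounded (suc j))
    ; distinct = blurSet-unique (suc j)
    ; sumZero  = All.map (λ sum≡ → subst (2 ^ suc m ∣_) (trans 2^[1+m]≡ (sym sum≡)) ∣-refl) (blurSet-sum (suc j))
    ; cond2    = λ where
        (true ∷ N) ∣N∣ refl → cong (_% 2) (trans (matchCount-blurSet-∈-a j N _ (suc-injective ∣N∣) (LP.length-replicate j))
                                                  (completions-zeros (2 + j) j))
        (false ∷ N) _ ()
    ; cond3    = λ where
        (false ∷ N) ∣N∣ refl → cong (_% 2) (trans (matchCount-blurSet-∉ (suc j) N _ ∣N∣ (LP.length-replicate (suc j)))
                                                   (completions-zeros (2 + j) (suc j)))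
        (true ∷ N) _ ()
    ; cond4    = λ where
        (true ∷ N) ∣N∣ (y ∷ b) _ b≢a _ →
          matchCount-blurSet-∈-even N y (toList b) (suc-injective ∣N∣) (VecP.length-toList b) (b≢a refl)
        (false ∷ N) ∣N∣ b _ _ b≢0 →
          matchCount-blurSet-∉-even N (toList b) ∣N∣ (VecP.length-toList b) (b≢0 refl)
    }
    where
    2^[1+m]≡ : 2 ^ suc m ≡ (2 + j) + (2 + j)
    2^[1+m]≡ = trans (cong (2 *_) (sym 2+j≡2^m)) (cong (2 + j +_) (+-identityʳ (2 + j)))

    bound : 4 + j ≤ 2 ^ suc m
    bound = subst (4 + j ≤_) (sym 2^[1+m]≡) (s≤s (s≤s (m≤n+m (2 + j) j)))

singleton-isBlurer : IsBlurer 0 1 1 1 ((0 ∷ []) ∷ [])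
singleton-isBlurer = record
  { k≤d      = z≤n
  ; a∈Z      = s≤s (s≤s z≤n)
  ; inZ      = (z<s VecAll.∷ VecAll.[]) All.∷ All.[]
  ; distinct = All.[] ∷ []
  ; sumZero  = (2 ∣0) All.∷ All.[]
  ; cond2    = λ where (true ∷ []) () _
                       (false ∷ []) _ ()
  ; cond3    = λ where (false ∷ []) _ _ → refl
                       (true ∷ []) () _
  ; cond4    = λ where (true ∷ []) () _ _ _ _
                       (false ∷ []) _ [] _ _ b≢0 → contradiction refl (b≢0 refl)
  }

pow2-blurer : ∀ m n → 2 ≤ n → n ≡ 2 ^ m → Blurer (n ∸ 1) (suc m) n (2 * n ∸ 1)
pow2-blurer m (suc (suc j)) (s≤s (s≤s z≤n)) n≡2^m =
  subst (Blurer (suc j) (suc m) (2 + j)) d≡ (blurSet (suc j) , blurSet-isBlurer m j n≡2^m)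
  where
  d≡ : suc (suc j + suc j) ≡ 2 * (2 + j) ∸ 1
  d≡ = cong suc (sym (trans (cong (j +_) (+-identityʳ (2 + j))) (+-suc j (suc j))))

mainTheorem10 : (i : ℕ) → 1 ≤ i →
    Blurer (2 ^ (i ∸ 1) ∸ 1) i (2 ^ (i ∸ 1)) (2 ^ i ∸ 1)
mainTheorem10 (suc zero)    _ = (0 ∷ []) ∷ [] , singleton-isBlurer
mainTheorem10 (suc (suc m)) _ = pow2-blurer (suc m) (2 ^ suc m) (^-monoʳ-≤ 2 {1} {suc m} (s≤s z≤n)) refl
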